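{- Let $(X,i)$ be an HDA and $(\tilde x_1,\dots,\tilde x_m)$ a pointed cube path in its unfolding $\tilde X$. Then $(\pi_X\tilde x_1,\dots,\pi_X\tilde x_j)\in\tilde x_j$ for all $j=1,\dots,m$.
   Context: A precubical set $X$ is a family of pairwise disjoint sets $(X_n)_{n\ge0}$ with face maps $\delta_k^\nu:X_n\to X_{n-1}$ ($n\ge1$, $1\le k\le n$, $\nu\in\{0,1\}$) satisfying $\delta_k^\nu\delta_\ell^\mu=\delta_{\ell-1}^\mu\delta_k^\nu$ for $k<\ell$. An HDA is a precubical set with a distinguished $0$-cube $i$. A cube path is a sequence $(x_1,\dots,x_m)$ with, for each $j<m$, $x_j=\delta_k^0x_{j+1}$ or $x_{j+1}=\delta_k^1x_j$ for some $k$; pointed if $x_1$ is the distinguished point. Two cube paths $(x_1,\dots,x_m)$, $(y_1,\dots,y_m)$ are adjacent if $x_1=y_1$, $x_m=y_m$, exactly one index $p$ has $x_p\ne y_p$, and for some $k<\ell$ one of the following holds, or holds with the paths interchanged: (i) $x_{p-1}=\delta_k^0x_p$, $x_p=\delta_\ell^0x_{p+1}$, $y_{p-1}=\delta_{\ell-1}^0y_p$, $y_p=\delta_k^0y_{p+1}$; (ii) $x_p=\delta_k^1x_{p-1}$, $x_{p+1}=\delta_\ell^1x_p$, $y_p=\delta_{\ell-1}^1y_{p-1}$, $y_{p+1}=\delta_k^1y_p$; (iii) $x_p=\delta_k^0\delta_\ell^1y_p$, $y_{p-1}=\delta_k^0y_p$, $y_{p+1}=\delta_\ell^1y_p$; (iv)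 $x_p=\delta_k^1\delta_\ell^0y_p$, $y_{p-1}=\delta_\ell^0y_p$, $y_{p+1}=\delta_k^1y_p$. Homotopy $\sim$ is the reflexive transitive closure of adjacency. The unfolding of $(X,i)$ is the HDA $\tilde X$ with $\tilde X_n$ = homotopy classes $[x_1,\dots,x_m]$ of pointed cube paths with $x_m\in X_n$, point $[i]$, face maps $\tilde\delta_k^1[x_1,\dots,x_m]=[x_1,\dots,x_m,\delta_k^1x_m]$ and $\tilde\delta_k^0[x_1,\dots,x_m]=\{(y_1,\dots,y_p)\mid y_p=\delta_k^0x_m,(y_1,\dots,y_p,x_m)\sim(x_1,\dots,x_m)\}$ (a homotopy class), and projection $\pi_X:\tilde X\to X$, $\pi_X[x_1,\dots,x_m]=x_m$; cube paths in $\tilde X$ are taken with respect to the face maps $\tilde\delta_k^\nu$, pointed meaning starting at $[i]$. -}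

module Defs where

open import Data.Nat using (ℕ; zero; suc; _<_; _∸_)
open import Data.Fin using (Fin; fromℕ<; inject₁; suc; toℕ)
open import Data.Bool using (Bool; true; false)
open import Data.Product using (Σ; ∃; _×_; _,_)
open import Data.Sum using (_⊎_)
open import Data.List using (List; []; _∷_; _++_; map)
open import Data.List.NonEmpty using (List⁺; _∷_; toList; last; _∷ʳ_; [_])
open import Data.List.Relation.Unary.Linked using (Linked)
open import Data.List.Relation.Unary.All using (All)
open import Relation.Binary.PropositionalEquality using (_≡_; _≢_)
open import Relation.Binary.Construct.Closure.ReflexiveTransitive using (Star)
open import Data.Nat using (_≤_)

-- Face maps are 0-indexed: the paper's δ_{k+1} on X_{n+1}
-- is  δ k  with  k : Fin (suc n).  The precubical identity
-- δ_k δ_ℓ = δ_{ℓ-1} δ_k (k<ℓ, 1-based) becomes, with ℓ = suc ℓ' 0-based: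
record Precubical : Set₁ where
  field
    X   : ℕ → Set
    δ   : ∀ {n} → Fin (suc n) → Bool → X (suc n) → X n
    law : ∀ {n} (k ℓ : Fin (suc n)) → toℕ k ≤ toℕ ℓ → ∀ ν μ (x : X (suc (suc n))) →
          δ k ν (δ (suc ℓ) μ x) ≡ δ ℓ μ (δ (inject₁ k) ν x)

record HDA : Set₁ where
  field
    pc : Precubical
  open Precubical pc public
  field
    i : X 0

module _ (H : HDA) where
  open HDA H

  Cube : Set
  Cube = Σ ℕ X

  data IsFace (ν : Bool) (k : ℕ) : Cube → Cube → Set where
    isFace : ∀ {n} {a : X n} (b : X (suc n)) (p : k < suc n) →
             a ≡ δ (fromℕ< p) ν b → IsFace ν k (n , a) (suc n , b)

  Step : Cube → Cube → Set
  Step x y = (∃ λ k → IsFace false k x y) ⊎ (∃ λ k → IsFace true k y x)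

  Path : Set
  Path = List⁺ Cube

  IsCubePath : Path → Set
  IsCubePath xs = Linked Step (toList xs)

  iCube : Cube
  iCube = (0 , i)

  IsPointed : Path → Set
  IsPointed (x ∷ _) = x ≡ iCube

  PointedCubePath : Path → Set
  PointedCubePath xs = IsPointed xs × IsCubePath xs

  AdjCond : ℕ → ℕ → Cube → Cube → Cube → Cube → Set
  AdjCond k ℓ a x y b =
      (IsFace false k a x × IsFace false ℓ x b × IsFace false (ℓ ∸ 1) a y × IsFace false k y b)
    ⊎ (IsFace true k x a × IsFace true ℓ b x × IsFace true (ℓ ∸ 1) y a × IsFace true k b y)
    ⊎ ((∃ λ c → IsFace true ℓ c y × IsFace false k x c) × IsFace false k a y × IsFace true ℓ b y)
    ⊎ ((∃ λ c → IsFace false ℓ c y × IsFace true k x c) × IsFace false ℓ a y × IsFace true k b y)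

  AdjLocal : Cube → Cube → Cube → Cube → Set
  AdjLocal a x y b = ∃ λ k → ∃ λ ℓ → k < ℓ × (AdjCond k ℓ a x y b ⊎ AdjCond k ℓ a y x b)

  Adjacent : Path → Path → Set
  Adjacent xs ys = IsCubePath xs × IsCubePath ys ×
    (∃ λ (pre : List Cube) → ∃ λ (post : List Cube) → ∃ λ a → ∃ λ b → ∃ λ x → ∃ λ y →
      toList xs ≡ pre ++ a ∷ x ∷ b ∷ post ×
      toList ys ≡ pre ++ a ∷ y ∷ b ∷ post ×
      x ≢ y × AdjLocal a x y b)

  _∼_ : Path → Path → Set
  _∼_ = Star Adjacent

  _∈[_] : Path → Path → Set
  z ∈[ xs ] = PointedCubePath z × (z ∼ xs)

  -- The unfolding X̃.  An element of X̃ is represented by a pointed cube path xs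
  -- (standing for its class [xs]); π [xs] = last xs.
  π : Path → Cube
  π = last

  IsFacẽ1 : ℕ → Path → Path → Set
  IsFacẽ1 k ys xs = ∃ λ c → IsFace true k c (last xs) × (ys ∼ (toList xs ∷ʳ c))

  -- [ys] = δ̃_k^0 [xs]  i.e. the class [ys] equals, as a set of paths,
  -- { z | z_p = δ_k^0 x_m , (z , x_m) ∼ xs }
  IsFacẽ0 : ℕ → Path → Path → Set
  IsFacẽ0 k ys xs = ∀ z →
    ((z ∈[ ys ]) → (IsFace false k (last z) (last xs) × ((toList z ∷ʳ last xs) ∈[ xs ])))
    × ((IsFace false k (last z) (last xs) × ((toList z ∷ʳ last xs) ∈[ xs ])) → (z ∈[ ys ]))

  Step̃ : Path → Path → Set
  Step̃ xs ys = (∃ λ k → IsFacẽ0 k xs ys) ⊎ (∃ λ k → IsFacẽ1 k ys xs)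

  PointedCubePath̃ : List⁺ Path → Set
  PointedCubePath̃ (x̃ ∷ x̃s) =
    All PointedCubePath (x̃ ∷ x̃s) × (x̃ ∼ [ iCube ]) × Linked Step̃ (x̃ ∷ x̃s)

-- The class x̃₁ is [i], and a one-cube
-- path is homotopic only to itself, so (π x̃₁) ∈ x̃₁.  Suppose z ∈ x̃ⱼ.  If
-- x̃ⱼ = δ̃⁰ₖ x̃ⱼ₊₁, then (z, π x̃ⱼ₊₁) ∈ x̃ⱼ₊₁ is the definition of δ̃⁰.  If
-- x̃ⱼ₊₁ = δ̃¹ₖ x̃ⱼ = [x̃ⱼ, c], then z ends where x̃ⱼ does (homotopies fix
-- endpoints), and a homotopy z ∼ x̃ⱼ extends along the common step to c.
module Submission where

open import Defs
open import Data.List using (List; []; _∷_; _++_; map)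
import Data.List as List
open import Data.List.NonEmpty using (List⁺; _∷_; toList; _∷ʳ_; _⁺∷ʳ_; last; [_])
open import Data.List.Properties using (++-assoc; ++-identityʳ; ++-conicalʳ; ∷-injective)
open import Data.List.Relation.Unary.Linked using (Linked; [-]; _∷_)
open import Data.Product using (_,_; proj₁; proj₂)
open import Data.Sum using (inj₁; inj₂; swap)
open import Function using (_∘_)
open import Relation.Binary.Core using (Rel)
open import Relation.Binary.Definitions using (Symmetric)
open import Relation.Binary.Construct.Closure.ReflexiveTransitive using (ε; _◅_; _◅◅_; reverse)
open import Relation.Binary.PropositionalEquality using (_≡_; refl; sym; trans; cong; subst)
open import Relation.Nullary using (¬_; contradiction)

module _ {A : Set} where

  last-∷ : (x y : A) (ys : List A) → last (x ∷ y ∷ ys) ≡ last (y ∷ ys)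
  last-∷ x y ys with List.initLast ys
  ... | []            = refl
  ... | zs List.∷ʳ′ z = refl

  last-∷ʳ : (xs : List A) (y : A) → last (xs ∷ʳ y) ≡ y
  last-∷ʳ []           y = refl
  last-∷ʳ (x ∷ [])     y = refl
  last-∷ʳ (x ∷ z ∷ zs) y = trans (last-∷ x z (zs List.∷ʳ y)) (last-∷ʳ (z ∷ zs) y)

  last-++-∷ : (x : A) (xs : List A) (y : A) (ys : List A) →
              last (x ∷ xs ++ y ∷ ys) ≡ last (y ∷ ys)
  last-++-∷ x []       y ys = last-∷ x y ys
  last-++-∷ x (z ∷ zs) y ys = trans (last-∷ x z (zs ++ y ∷ ys)) (last-++-∷ z zs y ys)

  last-suffix : (xs : List⁺ A) (ys : List A) (y : A) (zs : List A) →
                toList xs ≡ ys ++ y ∷ zs → last xs ≡ last (y ∷ zs)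
  last-suffix _ []       y zs refl = refl
  last-suffix _ (x ∷ ys) y zs refl = last-++-∷ x ys y zs

  toList-∷ʳ : (xs : List A) (y : A) → toList (xs ∷ʳ y) ≡ xs ++ y ∷ []
  toList-∷ʳ []       y = refl
  toList-∷ʳ (x ∷ xs) y = refl

  Linked-⁺∷ʳ : ∀ {ℓ} {R : Rel A ℓ} (xs : List⁺ A) {y : A} →
               Linked R (toList xs) → R (last xs) y → Linked R (toList (xs ⁺∷ʳ y))
  Linked-⁺∷ʳ (x ∷ [])     [-]        Rxy = Rxy ∷ [-]
  Linked-⁺∷ʳ {R = R} (x ∷ z ∷ zs) {y} (Rxz ∷ Rs) Rxy =
    Rxz ∷ Linked-⁺∷ʳ (z ∷ zs) Rs (subst (λ w → R w y) (last-∷ x z zs) Rxy)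

module _ (H : HDA) where

  Adjacent-sym : Symmetric (Adjacent H)
  Adjacent-sym (cx , cy , pre , post , a , b , x , y , ex , ey , x≢y , k , ℓ , k<ℓ , cond) =
    cy , cx , pre , post , a , b , y , x , ey , ex , x≢y ∘ sym , k , ℓ , k<ℓ , swap cond

  ∼-sym : Symmetric (_∼_ H)
  ∼-sym = reverse Adjacent-sym

  Adjacent⇒last≡ : ∀ {xs ys} → Adjacent H xs ys → last xs ≡ last ys
  Adjacent⇒last≡ {xs} {ys} (_ , _ , pre , post , a , b , x , y , ex , ey , _) =
    trans (spliced xs x ex) (sym (spliced ys y ey))
    where
      spliced : ∀ zs w → toList zs ≡ pre ++ a ∷ w ∷ b ∷ post → last zs ≡ last (b ∷ post)
      spliced zs w e = trans (last-suffix zs pre a (w ∷ b ∷ post) e)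
                             (trans (last-∷ a w (b ∷ post)) (last-∷ w b post))

  ∼⇒last≡ : ∀ {xs ys} → _∼_ H xs ys → last xs ≡ last ys
  ∼⇒last≡ ε             = refl
  ∼⇒last≡ (adj ◅ xs∼ys) = trans (Adjacent⇒last≡ adj) (∼⇒last≡ xs∼ys)

  Adjacent-⁺∷ʳ : ∀ {xs ys c} → Adjacent H xs ys → Step H (last xs) c →
                 Adjacent H (xs ⁺∷ʳ c) (ys ⁺∷ʳ c)
  Adjacent-⁺∷ʳ {xs} {ys} {c} adj@(cx , cy , pre , post , a , b , x , y , ex , ey , rest) step =
    Linked-⁺∷ʳ xs cx step ,
    Linked-⁺∷ʳ ys cy (subst (λ w → Step H w c) (Adjacent⇒last≡ adj) step) ,
    pre , post ++ c ∷ [] , a , b , x , y , extend xs x ex , extend ys y ey , rest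
    where
      extend : ∀ zs w → toList zs ≡ pre ++ a ∷ w ∷ b ∷ post →
               toList (zs ⁺∷ʳ c) ≡ pre ++ a ∷ w ∷ b ∷ post ++ c ∷ []
      extend zs w e = trans (toList-∷ʳ (toList zs) c)
                            (trans (cong (_++ c ∷ []) e) (++-assoc pre (a ∷ w ∷ b ∷ post) (c ∷ [])))

  ∼-⁺∷ʳ : ∀ {xs ys c} → _∼_ H xs ys → Step H (last xs) c → _∼_ H (xs ⁺∷ʳ c) (ys ⁺∷ʳ c)
  ∼-⁺∷ʳ ε                     step = ε
  ∼-⁺∷ʳ {c = c} (adj ◅ xs∼ys) step =
    Adjacent-⁺∷ʳ adj step ◅ ∼-⁺∷ʳ xs∼ys (subst (λ w → Step H w c) (Adjacent⇒last≡ adj) step)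

  ∈[]-⁺∷ʳ : ∀ {z xs c} → _∈[_] H z xs → Step H (last xs) c → _∈[_] H (z ⁺∷ʳ c) (xs ⁺∷ʳ c)
  ∈[]-⁺∷ʳ {z ∷ zs} {c = c} ((pointed , cz) , z∼xs) step =
    (pointed , Linked-⁺∷ʳ (z ∷ zs) cz step′) , ∼-⁺∷ʳ z∼xs step′
    where
      step′ : Step H (last (z ∷ zs)) c
      step′ = subst (λ w → Step H w c) (sym (∼⇒last≡ z∼xs)) step

  ∈[]-resp-∼ : ∀ {z xs ys} → _∈[_] H z xs → _∼_ H xs ys → _∈[_] H z ys
  ∈[]-resp-∼ (pcp , z∼xs) xs∼ys = pcp , z∼xs ◅◅ xs∼ys

  ∈[]-Step̃ : ∀ {z x̃ ỹ} → _∈[_] H z x̃ → Step̃ H x̃ ỹ → _∈[_] H (z ⁺∷ʳ π H ỹ) ỹ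
  ∈[]-Step̃ {z} z∈x̃ (inj₁ (k , x̃≡δ̃⁰ỹ)) = proj₂ (proj₁ (x̃≡δ̃⁰ỹ z) z∈x̃)
  ∈[]-Step̃ {z} {x̃} {ỹ} z∈x̃ (inj₂ (k , c , c≡δ¹ , ỹ∼x̃c)) =
    subst (λ w → _∈[_] H (z ⁺∷ʳ w) ỹ) (sym πỹ≡c)
      (∈[]-resp-∼ (∈[]-⁺∷ʳ z∈x̃ (inj₂ (k , c≡δ¹))) (∼-sym ỹ∼x̃c))
    where
      πỹ≡c : π H ỹ ≡ c
      πỹ≡c = trans (∼⇒last≡ ỹ∼x̃c) (last-∷ʳ (toList x̃) c)

  ¬Adjacent-[_] : ∀ {xs} c → ¬ Adjacent H xs [ c ]
  ¬Adjacent-[ c ] (_ , _ , [] , _ , _ , _ , _ , _ , _ , () , _)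
  ¬Adjacent-[ c ] (_ , _ , _ ∷ [] , _ , _ , _ , _ , _ , _ , () , _)
  ¬Adjacent-[ c ] (_ , _ , _ ∷ _ ∷ _ , _ , _ , _ , _ , _ , _ , () , _)

  ∼-[_]⇒≡ : ∀ {xs} c → _∼_ H xs [ c ] → xs ≡ [ c ]
  ∼-[ c ]⇒≡ ε = refl
  ∼-[ c ]⇒≡ (adj ◅ xs∼[c]) with refl ← ∼-[ c ]⇒≡ xs∼[c] = contradiction adj ¬Adjacent-[ c ]

  [π]∈[] : ∀ {x̃} → _∼_ H x̃ [ iCube H ] → _∈[_] H [ π H x̃ ] x̃
  [π]∈[] x̃∼[i] with refl ← ∼-[ iCube H ]⇒≡ x̃∼[i] = (refl , [-]) , ε

  prefix-∈[] : ∀ (acc : List (Cube H)) {x̃ rest} → _∈[_] H (acc ∷ʳ π H x̃) x̃ →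
               Linked (Step̃ H) (x̃ ∷ rest) →
               ∀ pre x post → x̃ ∷ rest ≡ pre ++ x ∷ post →
               _∈[_] H ((acc ++ map (π H) pre) ∷ʳ π H x) x
  prefix-∈[] acc acc∈x̃ _ [] x post refl =
    subst (λ l → _∈[_] H (l ∷ʳ π H x) x) (sym (++-identityʳ acc)) acc∈x̃
  prefix-∈[] acc _ [-] (_ ∷ pre) x post eq
    with () ← ++-conicalʳ pre (x ∷ post) (sym (proj₂ (∷-injective eq)))
  prefix-∈[] acc {x̃} acc∈x̃ (step ∷ steps) (_ ∷ pre) x post eq
    with refl , rest≡ ← ∷-injective eq =
    subst (λ l → _∈[_] H (l ∷ʳ π H x) x) shift
      (prefix-∈[] (toList (acc ∷ʳ π H x̃)) (∈[]-Step̃ acc∈x̃ step) steps pre x post rest≡)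
    where
      shift : toList (acc ∷ʳ π H x̃) ++ map (π H) pre ≡ acc ++ map (π H) (x̃ ∷ pre)
      shift = trans (cong (_++ map (π H) pre) (toList-∷ʳ acc (π H x̃)))
                    (++-assoc acc (π H x̃ ∷ []) (map (π H) pre))

lemma4p5 : (H : HDA) (x̃s : List⁺ (Path H)) → PointedCubePath̃ H x̃s →
    ∀ (pre : List (Path H)) (x̃ : Path H) (post : List (Path H)) →
    toList x̃s ≡ pre ++ x̃ ∷ post →
    _∈[_] H (map (π H) pre ∷ʳ π H x̃) x̃
lemma4p5 H (x̃₁ ∷ _) (_ , x̃₁∼[i] , steps) = prefix-∈[] H [] ([π]∈[] H x̃₁∼[i]) steps
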